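{- Let $G$ be a clockwise blue-red hackenbush position whose trunk has vertices $s_0,s_1,\ldots,s_n$ and edges $t_1,\ldots,t_n$, labelled from bottom (ground $s_0$) to top, where $t_i$ joins $s_{i-1}$ and $s_i$. For $1\le i\le n$ let $G_i$ be the position resulting from deleting $t_i$ (and everything thereby disconnected from the ground); let $S_1=G_1$ and, for $i>1$, $S_i=G_i\setminus(G_{i-1}\cup\{t_{i-1}\})$ (the part of the tree hanging above $t_{i-1}$ at $s_{i-1}$ that does not contain $t_i$); and let $M_i=S_i\cup\{t_i\}$, regarded as a clockwise blue-red hackenbush position with ground vertex $s_{i-1}$ (its trunk is the single edge $t_i$). Then, as games, $$G=M_1:(M_2:(\cdots:(M_{n-1}:M_n)\cdots)).$$
   Context: A clockwise hackenbush position is a finite tree rooted at a ground vertex and embedded in the plane (so the child edges at each vertex are ordered from left to right), each edge coloured blue, red or green; in the blue-red version all edges are blue or red. The trunk is the path obtained by starting at the ground and repeatedly following the rightmost edge to a child until a leaf is reached. Players Left and Right alternate; Left may remove a blue or green edge of the trunk, Right a red or green edge of the trunk; afterwards every edge no longer connected to the ground is removed (the embedding is kept, so the trunk is recomputed). Normal play: a player unable to move loses. Positions are regarded as game forms. For game forms $A,B$, the ordinal sum is $A:B=\{A^{\mathcal L},A:B^{\mathcal L}\,|\,A^{\mathcal R},A:B^{\mathcal R}\}$ (options of the literal form of the base $A$ and of the subordinate $B$; a move in $A$ annihilates $B$). -}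

module Defs where

open import Data.Nat using (ℕ; zero; suc; _+_; _≤_)
open import Data.List using (List; []; _∷_; _++_; map)
open import Data.Product using (_×_; _,_)
open import Data.Unit using (⊤)
open import Relation.Nullary using (¬_)

data Game : Set where
  ⟨_∣_⟩ : List Game → List Game → Game

leftOpts : Game → List Game
leftOpts ⟨ L ∣ R ⟩ = L

rightOpts : Game → List Game
rightOpts ⟨ L ∣ R ⟩ = R

mutual
  _≤G_ : Game → Game → Set
  ⟨ GL ∣ GR ⟩ ≤G ⟨ HL ∣ HR ⟩ = noLeftAbove GL ⟨ HL ∣ HR ⟩ × noRightBelow ⟨ GL ∣ GR ⟩ HR

  noLeftAbove : List Game → Game → Set
  noLeftAbove [] H = ⊤
  noLeftAbove (gl ∷ gls) H = ¬ (H ≤G gl) × noLeftAbove gls H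

  noRightBelow : Game → List Game → Set
  noRightBelow G [] = ⊤
  noRightBelow G (hr ∷ hrs) = ¬ (hr ≤G G) × noRightBelow G hrs

_≈G_ : Game → Game → Set
G ≈G H = (G ≤G H) × (H ≤G G)

mutual
  _∶_ : Game → Game → Game
  A ∶ ⟨ BL ∣ BR ⟩ = ⟨ leftOpts A ++ ordAll A BL ∣ rightOpts A ++ ordAll A BR ⟩

  ordAll : Game → List Game → List Game
  ordAll A [] = []
  ordAll A (b ∷ bs) = (A ∶ b) ∷ ordAll A bs

-- Right-nested ordinal sum  M₁ : (M₂ : (⋯ : (M_{n-1} : M_n)⋯)).
-- (The value on the empty list is never used by the theorem, which
-- assumes n ≥ 1.)
ordChain : List Game → Game
ordChain [] = ⟨ [] ∣ [] ⟩
ordChain (x ∷ []) = x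
ordChain (x ∷ y ∷ ys) = x ∶ ordChain (y ∷ ys)

data Colour : Set where
  blue red : Colour

-- A finite plane tree rooted at the ground vertex.
-- CONVENTION: the child edges are listed from RIGHT to LEFT, so the head
-- of the list is the rightmost edge (the one the trunk follows).
data Tree : Set where
  node : List (Colour × Tree) → Tree

leaf : Tree
leaf = node []

mutual
  size : Tree → ℕ
  size (node es) = sizeEs es

  sizeEs : List (Colour × Tree) → ℕ
  sizeEs [] = 0
  sizeEs ((c , t) ∷ es) = suc (size t + sizeEs es)

trunkLength : Tree → ℕ
trunkLength (node []) = 0
trunkLength (node ((c , t) ∷ es)) = suc (trunkLength t)

-- All moves: for each trunk edge t_i (bottom to top), its colour and the
-- position G_i resulting from deleting t_i together with everything that
-- is thereby disconnected from the ground.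
moves : Tree → List (Colour × Tree)
moves (node []) = []
moves (node ((c , t) ∷ es)) =
  (c , node es) ∷ map (λ { (c' , t') → (c' , node ((c , t') ∷ es)) }) (moves t)

leftMoves : List (Colour × Tree) → List Tree
leftMoves [] = []
leftMoves ((blue , t) ∷ ms) = t ∷ leftMoves ms
leftMoves ((red , t) ∷ ms) = leftMoves ms

rightMoves : List (Colour × Tree) → List Tree
rightMoves [] = []
rightMoves ((blue , t) ∷ ms) = rightMoves ms
rightMoves ((red , t) ∷ ms) = t ∷ rightMoves ms

-- Game form of a position, by recursion with fuel; every move strictly
-- decreases the number of edges, so fuel = size t is sufficient and
-- gameOf t is the genuine game form of t.
gameWithFuel : ℕ → Tree → Game
gameWithFuel zero t = ⟨ [] ∣ [] ⟩
gameWithFuel (suc k) t =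
  ⟨ map (gameWithFuel k) (leftMoves (moves t)) ∣ map (gameWithFuel k) (rightMoves (moves t)) ⟩

gameOf : Tree → Game
gameOf t = gameWithFuel (size t) t

-- S_i : the part of the tree hanging at s_{i-1} not containing t_i
--       (for i = 1 this is G_1), as a position with ground s_{i-1}.
-- M_i = S_i ∪ {t_i}, with t_i the rightmost edge at s_{i-1} leading to
--       the leaf s_i (so its trunk is the single edge t_i).
addTrunkEdge : Colour → Tree → Tree
addTrunkEdge c (node es) = node ((c , leaf) ∷ es)

trunkPieces : Tree → List Tree
trunkPieces (node []) = []
trunkPieces (node ((c , t) ∷ es)) = addTrunkEdge c (node es) ∷ trunkPieces t

-- The two sides are in fact equal as game forms.  Write G = graft c es t, where
-- t is the subtree above the bottom trunk edge t₁ and es are the edges beside it.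
-- Deleting t₁ gives the same position as deleting t₁ in M₁ = addTrunkEdge c (node es),
-- while deleting a trunk edge of t leaves t₁ and es in place, i.e. it is the move of
-- t regrafted onto M₁.  So, by well-founded induction on the size of t, the options of
-- G are those of M₁ followed by M₁ : tᴸ and M₁ : tᴿ, which is M₁ : t; iterating up the
-- trunk yields the chain of ordinal sums, and ≈G then holds by reflexivity.
module Submission where

open import Defs
open import Data.Nat using (zero; suc; _≤_; _<_; s≤s)
open import Data.Nat.Properties using (≤-refl; ≤-trans; ≤-pred; m≤n+m; +-monoˡ-<)
open import Data.Nat.Induction using (<-wellFounded)
open import Data.List using (List; []; _∷_; _++_; map)
open import Data.List.Properties using (map-++; map-∘; map-cong-local)
open import Data.List.Membership.Propositional using (_∈_)
open import Data.List.Relation.Binary.Subset.Propositional using (_⊆_)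
open import Data.List.Relation.Unary.All as All using (All; []; _∷_)
open import Data.List.Relation.Unary.All.Properties using (map⁺)
open import Data.List.Relation.Unary.Any using (here; there)
open import Data.Product using (_×_; _,_; proj₂; map₂)
open import Data.Unit using (tt)
open import Function using (_∘_; _on_)
open import Induction.WellFounded using (WellFounded; WfRec; module All)
open import Relation.Binary.Construct.On using (wellFounded)
open import Relation.Binary.PropositionalEquality
open import Relation.Nullary using (¬_)

noLeftAbove-∈ : ∀ {gs H g} → noLeftAbove gs H → g ∈ gs → ¬ (H ≤G g)
noLeftAbove-∈ (H≰g , _) (here refl) = H≰g
noLeftAbove-∈ (_ , rest) (there g∈gs) = noLeftAbove-∈ rest g∈gs

noRightBelow-∈ : ∀ {G gs g} → noRightBelow G gs → g ∈ gs → ¬ (g ≤G G)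
noRightBelow-∈ (g≰G , _) (here refl) = g≰G
noRightBelow-∈ (_ , rest) (there g∈gs) = noRightBelow-∈ rest g∈gs

mutual
  ≤G-refl : ∀ G → G ≤G G
  ≤G-refl ⟨ L ∣ R ⟩ = noLeftAbove-⊆ L (λ g∈L → g∈L) , noRightBelow-⊆ R (λ g∈R → g∈R)

  noLeftAbove-⊆ : ∀ {L R} gs → gs ⊆ L → noLeftAbove gs ⟨ L ∣ R ⟩
  noLeftAbove-⊆ [] _ = tt
  noLeftAbove-⊆ (g ∷ gs) gs⊆L = leftOption-≰ g (gs⊆L (here refl)) , noLeftAbove-⊆ gs (gs⊆L ∘ there)

  noRightBelow-⊆ : ∀ {L R} gs → gs ⊆ R → noRightBelow ⟨ L ∣ R ⟩ gs
  noRightBelow-⊆ [] _ = tt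
  noRightBelow-⊆ (g ∷ gs) gs⊆R = rightOption-≱ g (gs⊆R (here refl)) , noRightBelow-⊆ gs (gs⊆R ∘ there)

  leftOption-≰ : ∀ {L R} g → g ∈ L → ¬ (⟨ L ∣ R ⟩ ≤G g)
  leftOption-≰ g@(⟨ _ ∣ _ ⟩) g∈L (noneAbove , _) = noLeftAbove-∈ noneAbove g∈L (≤G-refl g)

  rightOption-≱ : ∀ {L R} g → g ∈ R → ¬ (g ≤G ⟨ L ∣ R ⟩)
  rightOption-≱ g@(⟨ _ ∣ _ ⟩) g∈R (_ , noneBelow) = noRightBelow-∈ noneBelow g∈R (≤G-refl g)

≈G-refl : ∀ G → G ≈G G
≈G-refl G = ≤G-refl G , ≤G-refl G

_⊏_ : Tree → Tree → Set
_⊏_ = _<_ on size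

⊏-wellFounded : WellFounded _⊏_
⊏-wellFounded = wellFounded size <-wellFounded

graft : Colour → List (Colour × Tree) → Tree → Tree
graft c es t = node ((c , t) ∷ es)

moves-⊏ : ∀ t → All ((_⊏ t) ∘ proj₂) (moves t)
moves-⊏ (node []) = []
moves-⊏ (node ((c , t) ∷ es)) =
  s≤s (m≤n+m (sizeEs es) (size t)) ∷ map⁺ (All.map (λ t'⊏t → s≤s (+-monoˡ-< (sizeEs es) t'⊏t)) (moves-⊏ t))

leftMoves-∷ : ∀ m ms → leftMoves (m ∷ ms) ≡ leftMoves (m ∷ []) ++ leftMoves ms
leftMoves-∷ (blue , _) _ = refl
leftMoves-∷ (red , _) _ = refl

rightMoves-∷ : ∀ m ms → rightMoves (m ∷ ms) ≡ rightMoves (m ∷ []) ++ rightMoves ms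
rightMoves-∷ (blue , _) _ = refl
rightMoves-∷ (red , _) _ = refl

leftMoves-map₂ : ∀ f ms → leftMoves (map (map₂ f) ms) ≡ map f (leftMoves ms)
leftMoves-map₂ f [] = refl
leftMoves-map₂ f ((blue , t) ∷ ms) = cong (f t ∷_) (leftMoves-map₂ f ms)
leftMoves-map₂ f ((red , _) ∷ ms) = leftMoves-map₂ f ms

rightMoves-map₂ : ∀ f ms → rightMoves (map (map₂ f) ms) ≡ map f (rightMoves ms)
rightMoves-map₂ f [] = refl
rightMoves-map₂ f ((blue , _) ∷ ms) = rightMoves-map₂ f ms
rightMoves-map₂ f ((red , t) ∷ ms) = cong (f t ∷_) (rightMoves-map₂ f ms)

leftMoves-All : ∀ {P : Tree → Set} {ms} → All (P ∘ proj₂) ms → All P (leftMoves ms)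
leftMoves-All {ms = []} [] = []
leftMoves-All {ms = (blue , _) ∷ _} (p ∷ ps) = p ∷ leftMoves-All ps
leftMoves-All {ms = (red , _) ∷ _} (_ ∷ ps) = leftMoves-All ps

rightMoves-All : ∀ {P : Tree → Set} {ms} → All (P ∘ proj₂) ms → All P (rightMoves ms)
rightMoves-All {ms = []} [] = []
rightMoves-All {ms = (blue , _) ∷ _} (_ ∷ ps) = rightMoves-All ps
rightMoves-All {ms = (red , _) ∷ _} (p ∷ ps) = p ∷ rightMoves-All ps

ordAll≡map : ∀ A bs → ordAll A bs ≡ map (A ∶_) bs
ordAll≡map A [] = refl
ordAll≡map A (b ∷ bs) = cong (A ∶ b ∷_) (ordAll≡map A bs)

module MoveSelection
  (select : List (Colour × Tree) → List Tree)
  (select-∷ : ∀ m ms → select (m ∷ ms) ≡ select (m ∷ []) ++ select ms)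
  (select-map₂ : ∀ f ms → select (map (map₂ f) ms) ≡ map f (select ms))
  (select-All : ∀ {P : Tree → Set} {ms} → All (P ∘ proj₂) ms → All P (select ms))
  where

  map-select-moves-cong : ∀ {A : Set} {f g : Tree → A} t → WfRec _⊏_ (λ t' → f t' ≡ g t') t →
    map f (select (moves t)) ≡ map g (select (moves t))
  map-select-moves-cong t f≡g = map-cong-local (select-All (All.map f≡g (moves-⊏ t)))

  map-select-moves-graft : ∀ {A : Set} {f : Tree → A} (h : A → A) c es t →
    WfRec _⊏_ (λ t' → f (graft c es t') ≡ h (f t')) t →
    map f (select (moves (graft c es t))) ≡
      map f (select (moves (addTrunkEdge c (node es)))) ++ map h (map f (select (moves t)))
  map-select-moves-graft {A} {f} h c es t IH = begin
      -- the anonymous relabelling in the definition of moves is definitionally map₂ (graft c es)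
      map f (select ((c , node es) ∷ map (map₂ (graft c es)) (moves t)))
    ≡⟨ cong (map f) (select-∷ (c , node es) _) ⟩
      map f (select ((c , node es) ∷ []) ++ select (map (map₂ (graft c es)) (moves t)))
    ≡⟨ map-++ f (select ((c , node es) ∷ [])) _ ⟩
      piece ++ map f (select (map (map₂ (graft c es)) (moves t)))
    ≡⟨ cong (λ ts → piece ++ map f ts) (select-map₂ (graft c es) (moves t)) ⟩
      piece ++ map f (map (graft c es) (select (moves t)))
    ≡⟨ cong (piece ++_) (sym (map-∘ (select (moves t)))) ⟩
      piece ++ map (f ∘ graft c es) (select (moves t))
    ≡⟨ cong (piece ++_) (map-select-moves-cong t IH) ⟩
      piece ++ map (h ∘ f) (select (moves t))
    ≡⟨ cong (piece ++_) (map-∘ (select (moves t))) ⟩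
      piece ++ map h (map f (select (moves t)))
    ∎
    where
    open ≡-Reasoning
    piece : List A
    piece = map f (select ((c , node es) ∷ []))

module Left = MoveSelection leftMoves leftMoves-∷ leftMoves-map₂ leftMoves-All
module Right = MoveSelection rightMoves rightMoves-∷ rightMoves-map₂ rightMoves-All

options : (Tree → Game) → Tree → Game
options f t = ⟨ map f (leftMoves (moves t)) ∣ map f (rightMoves (moves t)) ⟩

options-cong : ∀ {f g : Tree → Game} t → WfRec _⊏_ (λ t' → f t' ≡ g t') t → options f t ≡ options g t
options-cong t f≡g = cong₂ ⟨_∣_⟩ (Left.map-select-moves-cong t f≡g) (Right.map-select-moves-cong t f≡g)

gameWithFuel-irrelevant : ∀ k k' t → size t ≤ k → size t ≤ k' → gameWithFuel k t ≡ gameWithFuel k' t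
gameWithFuel-irrelevant zero zero t _ _ = refl
gameWithFuel-irrelevant zero (suc k') (node []) _ _ = refl
gameWithFuel-irrelevant (suc k) zero (node []) _ _ = refl
gameWithFuel-irrelevant (suc k) (suc k') t t≤k t≤k' =
  options-cong t (λ t'⊏t → gameWithFuel-irrelevant k k' _ (≤-pred (≤-trans t'⊏t t≤k)) (≤-pred (≤-trans t'⊏t t≤k')))

gameOf-unfold : ∀ t → gameOf t ≡ options gameOf t
gameOf-unfold (node []) = refl
gameOf-unfold t@(node (_ ∷ _)) = options-cong t (λ t'⊏t → gameWithFuel-irrelevant _ _ _ (≤-pred t'⊏t) ≤-refl)

∶-unfold : ∀ A BL BR → A ∶ ⟨ BL ∣ BR ⟩ ≡ ⟨ leftOpts A ++ map (A ∶_) BL ∣ rightOpts A ++ map (A ∶_) BR ⟩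
∶-unfold A BL BR = cong₂ (λ L R → ⟨ leftOpts A ++ L ∣ rightOpts A ++ R ⟩) (ordAll≡map A BL) (ordAll≡map A BR)

gameOf-graft : ∀ c es t → gameOf (graft c es t) ≡ gameOf (addTrunkEdge c (node es)) ∶ gameOf t
gameOf-graft c es = All.wfRec ⊏-wellFounded _ _ step
  where
  M : Tree
  M = addTrunkEdge c (node es)
  A : Game
  A = gameOf M
  step : ∀ t → WfRec _⊏_ (λ t' → gameOf (graft c es t') ≡ A ∶ gameOf t') t → gameOf (graft c es t) ≡ A ∶ gameOf t
  step t IH = begin
      gameOf (graft c es t)
    ≡⟨ gameOf-unfold (graft c es t) ⟩
      options gameOf (graft c es t)
    ≡⟨ cong₂ ⟨_∣_⟩ (Left.map-select-moves-graft (A ∶_) c es t IH) (Right.map-select-moves-graft (A ∶_) c es t IH) ⟩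
      ⟨ leftOpts (options gameOf M) ++ map (A ∶_) BL ∣ rightOpts (options gameOf M) ++ map (A ∶_) BR ⟩
    ≡⟨ cong (λ X → ⟨ leftOpts X ++ map (A ∶_) BL ∣ rightOpts X ++ map (A ∶_) BR ⟩) (sym (gameOf-unfold M)) ⟩
      ⟨ leftOpts A ++ map (A ∶_) BL ∣ rightOpts A ++ map (A ∶_) BR ⟩
    ≡⟨ sym (∶-unfold A BL BR) ⟩
      A ∶ options gameOf t
    ≡⟨ cong (A ∶_) (sym (gameOf-unfold t)) ⟩
      A ∶ gameOf t
    ∎
    where
    open ≡-Reasoning
    BL BR : List Game
    BL = map gameOf (leftMoves (moves t))
    BR = map gameOf (rightMoves (moves t))

gameOf≡ordChain : ∀ c es t → gameOf (graft c es t) ≡ ordChain (map gameOf (trunkPieces (graft c es t)))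
gameOf≡ordChain c es (node []) = refl
gameOf≡ordChain c es t@(node ((c' , t') ∷ es')) =
  trans (gameOf-graft c es t) (cong (gameOf (addTrunkEdge c (node es)) ∶_) (gameOf≡ordChain c' es' t'))

theorem2p2 : (G : Tree) → 1 ≤ trunkLength G →
    gameOf G ≈G ordChain (map gameOf (trunkPieces G))
theorem2p2 (node ((c , t) ∷ es)) _ = subst (gameOf (graft c es t) ≈G_) (gameOf≡ordChain c es t) (≈G-refl _)
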